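{- Let $F$ be an unsatisfiable clause-set and $x,y$ literals. Let $F_{x\leftarrow y}$ be the clause-set obtained from $F$ by replacing every occurrence of $x$ by $y$ and every occurrence of $\overline{x}$ by $\overline{y}$, and then removing all clauses containing a complementary pair of literals. Then $F_{x\leftarrow y}$ is unsatisfiable, $\mathrm{hd}(F_{x\leftarrow y})\le\mathrm{hd}(F)$ and $\mathrm{whd}(F_{x\leftarrow y})\le\mathrm{whd}(F)$.
   Context: Literals are variables $v$ or negations $\overline{v}$ ($\overline{\overline{v}}=v$); clauses finite sets of literals without complementary pair; clause-sets finite sets of clauses; $\bot$ empty clause. A partial assignment maps finitely many variables to $\{0,1\}$; $F$ is unsatisfiable if no partial assignment satisfies every clause. Resolution: $C,D$ with exactly one clash $x\in C,\overline{x}\in D$ have resolvent $(C\cup D)\setminus\{x,\overline{x}\}$. Resolution tree: finite rooted tree, inner nodes with two children, labelled by clauses, inner labels resolvents of children's labels; refutation of $F$: leaves in $F$, root $\bot$. Horton–Strahler number: $0$ for one node; for root subtrees $T_1,T_2$: $\mathrm{hts}(T_1)+1$ if equal, else the maximum. $\mathrm{hd}(F)$: minimum Horton–Strahler number of a refutation of $F$. Asymmetric width: $\mathrm{whd}(T)=0$ for a single node; otherwise, with root children labelled $C_1,C_2$ and subtrees $T_1,T_2$, $\mathrm{whd}(T)=\max(\mathrm{whd}(T_1),\mathrm{whd}(T_2),\min(|C_1|,|C_2|))$; $\mathrm{whd}(F)$: minimum over refutations of $F$. -}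

module Defs where

open import Data.Nat using (ℕ; zero; suc; _≤_; _⊔_; _⊓_; _≡ᵇ_)
import Data.Nat.Properties as ℕP
open import Data.Bool using (Bool; true; false; not; if_then_else_)
import Data.Bool.Properties as BoolP
open import Data.Product using (Σ; Σ-syntax; _×_; _,_; proj₁; proj₂)
open import Data.Product.Properties using (≡-dec)
open import Data.Sum using (_⊎_)
open import Data.Maybe using (Maybe; just; nothing)
open import Data.Unit using (⊤)
open import Data.List using (List; []; _∷_; map; length; deduplicate; mapMaybe)
open import Data.List.Relation.Unary.Any using (Any; any?)
open import Data.List.Relation.Unary.All using (All)
open import Data.List.Relation.Unary.Unique.Propositional using (Unique)
open import Relation.Binary.PropositionalEquality using (_≡_; _≢_)
open import Relation.Binary.Definitions using (DecidableEquality)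
open import Relation.Nullary using (¬_; yes; no; does)
open import Function.Bundles using (_⇔_)

-- Literals: a variable (ℕ) with a polarity (true = positive v, false = v̄)

Lit : Set
Lit = ℕ × Bool

var : Lit → ℕ
var = proj₁

neg : Lit → Lit
neg (v , b) = (v , not b)

_≟ₗ_ : DecidableEquality Lit
_≟ₗ_ = ≡-dec ℕP._≟_ BoolP._≟_

open import Data.List.Membership.DecPropositional _≟ₗ_ using (_∈_; _∉_; _∈?_)
open import Data.List.Relation.Unary.Unique.DecPropositional.Properties _≟ₗ_
  using (deduplicate-!)

-- Clauses: finite sets of literals (duplicate-free lists) without
-- complementary pair.  Order of the list is irrelevant (see _≈ᶜ_).

record Clause : Set where
  constructor mkClause
  field
    lits     : List Lit
    distinct : Unique lits
    noClash  : ∀ l → l ∈ lits → neg l ∉ lits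
open Clause public

_∈ᶜ_ : Lit → Clause → Set
l ∈ᶜ C = l ∈ lits C

_≈ᶜ_ : Clause → Clause → Set
C ≈ᶜ D = ∀ l → (l ∈ᶜ C) ⇔ (l ∈ᶜ D)

-- number of literals of a clause (= cardinality, since duplicate-free)
size : Clause → ℕ
size C = length (lits C)

IsEmpty : Clause → Set
IsEmpty C = lits C ≡ []

-- clause-sets (finite; duplicates in the list are irrelevant)
ClauseSet : Set
ClauseSet = List Clause

_∈ˢ_ : Clause → ClauseSet → Set
C ∈ˢ F = Any (λ D → C ≈ᶜ D) F

record PAss : Set where
  field
    val    : ℕ → Maybe Bool
    dom    : List ℕ
    finite : ∀ v → val v ≢ nothing → Any (v ≡_) dom
open PAss public

SatLit : PAss → Lit → Set
SatLit φ (v , b) = val φ v ≡ just b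

SatClause : PAss → Clause → Set
SatClause φ C = Any (SatLit φ) (lits C)

Satisfies : PAss → ClauseSet → Set
Satisfies φ F = All (SatClause φ) F

Unsat : ClauseSet → Set
Unsat F = ∀ (φ : PAss) → ¬ Satisfies φ F

substLit : Lit → Lit → Lit → Lit
substLit x y l with l ≟ₗ x
... | yes _ = y
... | no _ with l ≟ₗ neg x
...   | yes _ = neg y
...   | no _  = l

substClause : Lit → Lit → Clause → Maybe Clause
substClause x y C with any? (λ l → neg l ∈? L) L
  where L = deduplicate _≟ₗ_ (map (substLit x y) (lits C))
... | yes _ = nothing
... | no noPair = just (mkClause L (deduplicate-! _) (λ l l∈ nl∈ → noPair (lemma l l∈ nl∈)))
  where
    L = deduplicate _≟ₗ_ (map (substLit x y) (lits C))
    lemma : ∀ l → l ∈ L → neg l ∈ L → Any (λ l → neg l ∈ L) L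
    lemma l l∈ nl∈ = Data.List.Relation.Unary.Any.map (λ { _≡_.refl → nl∈ }) l∈
      where import Data.List.Relation.Unary.Any

substCS : Lit → Lit → ClauseSet → ClauseSet
substCS x y F = mapMaybe (substClause x y) F

Resolvent : Clause → Clause → Clause → Set
Resolvent C D R =
  Σ[ x ∈ Lit ] (x ∈ᶜ C) × (neg x ∈ᶜ D)
    × (∀ z → z ∈ᶜ C → neg z ∈ᶜ D → z ≡ x)
    × (∀ z → (z ∈ᶜ R) ⇔ (((z ∈ᶜ C) ⊎ (z ∈ᶜ D)) × z ≢ x × z ≢ neg x))

data RTree : Set where
  leaf : Clause → RTree
  node : Clause → RTree → RTree → RTree

label : RTree → Clause
label (leaf C) = C
label (node C _ _) = C

WellFormed : RTree → Set
WellFormed (leaf _) = ⊤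
WellFormed (node C T₁ T₂) = Resolvent (label T₁) (label T₂) C × WellFormed T₁ × WellFormed T₂

LeavesIn : ClauseSet → RTree → Set
LeavesIn F (leaf C) = C ∈ˢ F
LeavesIn F (node _ T₁ T₂) = LeavesIn F T₁ × LeavesIn F T₂

Refutation : ClauseSet → RTree → Set
Refutation F T = WellFormed T × LeavesIn F T × IsEmpty (label T)

hts : RTree → ℕ
hts (leaf _) = 0
hts (node _ T₁ T₂) = if hts T₁ ≡ᵇ hts T₂ then suc (hts T₁) else hts T₁ ⊔ hts T₂

whdT : RTree → ℕ
whdT (leaf _) = 0
whdT (node _ T₁ T₂) = whdT T₁ ⊔ whdT T₂ ⊔ (size (label T₁) ⊓ size (label T₂))

hd≤ : ClauseSet → ℕ → Set
hd≤ F k = Σ[ T ∈ RTree ] Refutation F T × hts T ≤ k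

whd≤ : ClauseSet → ℕ → Set
whd≤ F k = Σ[ T ∈ RTree ] Refutation F T × whdT T ≤ k

module Submission where

-- Write σ for the literal substitution x ↦ y, x̄ ↦ ȳ.
--
-- Unsatisfiability: from an assignment φ satisfying F_{x←y}, make φ
-- total at var y and pull it back along σ, i.e. let m be true iff σ m
-- is.  A clause C of F whose image σ(C) survives contains σ of some
-- literal satisfied by φ; a clause whose image is tautological contains
-- literals mapped to ȳ and to y, one of which holds.
--
-- Refutations: transform a resolution tree bottom-up.  For every node
-- labelled P, either σ(P) is tautological or there is a tree from
-- F_{x←y} deriving a subclause of σ(P) whose Horton–Strahler number and
-- asymmetric width are bounded by those of the subtree at P.  At an
-- inner node either one child's derivation already lies in σ(P) and is
-- reused, or both contain the image of the pivot and are resolved on it.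
-- Both measures are monotone in the children, and a new child label,
-- lying inside the image of the old one, is no larger than it.  The
-- root label is ⊥, whose image is ⊥.

open import Defs
open import Data.Nat using (ℕ; suc; _≤_; _⊔_; _⊓_; _≡ᵇ_; z≤n; s≤s)
import Data.Nat as ℕ
import Data.Nat.Properties as ℕₚ
open import Data.Bool using (Bool; true; false; not; T; if_then_else_)
open import Data.Bool.Properties using (not-involutive)
open import Data.Product using (Σ-syntax; ∃; _×_; _,_; proj₁; proj₂)
open import Data.Sum using (_⊎_; inj₁; inj₂; [_,_])
open import Data.Unit using (tt)
open import Data.Maybe using (Maybe; just; nothing; fromMaybe)
import Data.Maybe as Maybe
open import Data.List using (List; []; _∷_; _++_; map; mapMaybe; filter; deduplicate; length)
open import Data.List.Properties using (length-map; length-removeAt′)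
open import Data.List.Relation.Unary.Any using (Any; here; there; any?; index)
import Data.List.Relation.Unary.Any as Any
open import Data.List.Relation.Unary.Any.Properties using (++⁺ˡ; ++⁺ʳ)
import Data.List.Relation.Unary.All as All
open import Data.List.Relation.Unary.AllPairs using ([]; _∷_)
open import Data.List.Relation.Unary.Unique.Propositional using (Unique)
open import Data.List.Relation.Unary.Unique.Propositional.Properties using (filter⁺)
open import Data.List.Relation.Unary.Unique.DecPropositional.Properties _≟ₗ_ using (deduplicate-!)
open import Data.List.Membership.Propositional using (_∈_; _∉_; _─_; find; lose)
open import Data.List.Membership.Propositional.Properties
  using (∈-map⁻; ∈-++⁺ˡ; ∈-++⁺ʳ; ∈-++⁻; ∈-filter⁺; ∈-filter⁻; ∈-deduplicate⁺; ∈-deduplicate⁻)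
open import Data.List.Membership.DecPropositional _≟ₗ_ using (_∈?_)
open import Data.List.Relation.Binary.Subset.Propositional using (_⊆_)
open import Data.List.Relation.Binary.Subset.Propositional.Properties
  using (∈-∷⁺ʳ; ⊆∷⇒∈∨⊆; ⊆[]⇒≡[])
import Data.List.Relation.Binary.Subset.Propositional.Properties as ⊆
open import Relation.Binary.PropositionalEquality hiding ([_])
open import Relation.Nullary using (¬_; Dec; yes; no; contradiction; ¬?)
open import Relation.Nullary.Decidable using (_×-dec_)
open import Function using (id; _∘_)
open import Function.Bundles using (_⇔_; mk⇔; Equivalence)

neg-involutive : ∀ l → neg (neg l) ≡ l
neg-involutive (v , b) = cong (v ,_) (not-involutive b)

neg-injective : ∀ {l m} → neg l ≡ neg m → l ≡ m
neg-injective {l} {m} e = trans (sym (neg-involutive l)) (trans (cong neg e) (neg-involutive m))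

neg≢ : ∀ l → neg l ≢ l
neg≢ (v , true) ()
neg≢ (v , false) ()

var≡⇒≡⊎≡neg : ∀ l m → var l ≡ var m → l ≡ m ⊎ l ≡ neg m
var≡⇒≡⊎≡neg (v , true)  (v , true)  refl = inj₁ refl
var≡⇒≡⊎≡neg (v , true)  (v , false) refl = inj₂ refl
var≡⇒≡⊎≡neg (v , false) (v , true)  refl = inj₂ refl
var≡⇒≡⊎≡neg (v , false) (v , false) refl = inj₁ refl

Tautological : List Lit → Set
Tautological L = ∃ λ z → z ∈ L × neg z ∈ L

tautological? : (L : List Lit) → Dec (Tautological L)
tautological? L with any? (λ l → neg l ∈? L) L
... | yes p = yes (find p)
... | no ¬p = no (λ (z , z∈ , nz∈) → ¬p (lose z∈ nz∈))

tautological-⊆ : ∀ {A B} → A ⊆ B → Tautological A → Tautological B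
tautological-⊆ A⊆B (z , z∈ , nz∈) = z , A⊆B z∈ , A⊆B nz∈

tautological-⊆∷ : ∀ {A B k} → Tautological A → A ⊆ k ∷ B → ¬ Tautological B → neg k ∈ B
tautological-⊆∷ {k = k} (z , z∈ , nz∈) A⊆ ¬tautB with A⊆ z∈ | A⊆ nz∈
... | here refl  | here nz≡z  = contradiction nz≡z (neg≢ z)
... | here refl  | there nz∈B = nz∈B
... | there z∈B  | here refl  = subst (_∈ _) (sym (neg-involutive z)) z∈B
... | there z∈B  | there nz∈B = contradiction (z , z∈B , nz∈B) ¬tautB

∈-─ : ∀ {A : Set} {a z : A} {ys : List A} (a∈ : a ∈ ys) → z ∈ ys → z ≢ a → z ∈ ys ─ a∈
∈-─ (here refl) (here refl) z≢a = contradiction refl z≢a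
∈-─ (here refl) (there z∈)  _   = z∈
∈-─ (there a∈)  (here refl) _   = here refl
∈-─ (there a∈)  (there z∈)  z≢a = there (∈-─ a∈ z∈ z≢a)

Unique⇒length≤ : ∀ {A : Set} {xs ys : List A} → Unique xs → xs ⊆ ys → length xs ≤ length ys
Unique⇒length≤ {xs = []} _ _ = z≤n
Unique⇒length≤ {xs = a ∷ xs} {ys} (a∉xs ∷ unique) xs⊆ys = begin
  suc (length xs)          ≤⟨ s≤s (Unique⇒length≤ unique rest⊆) ⟩
  suc (length (ys ─ a∈ys)) ≡⟨ sym (length-removeAt′ ys (index a∈ys)) ⟩
  length ys                ∎
  where
  open ℕₚ.≤-Reasoning
  a∈ys = xs⊆ys (here refl)
  rest⊆ : xs ⊆ ys ─ a∈ys
  rest⊆ z∈ = ∈-─ a∈ys (xs⊆ys (there z∈)) (≢-sym (All.lookup a∉xs z∈))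

∈-mapMaybe⁺ : ∀ {A B : Set} (f : A → Maybe B) {a b xs} → a ∈ xs → f a ≡ just b → b ∈ mapMaybe f xs
∈-mapMaybe⁺ f {xs = a ∷ _} (here refl) fa≡b rewrite fa≡b = here refl
∈-mapMaybe⁺ f {xs = a ∷ _} (there a∈) fa≡b with f a
... | just _  = there (∈-mapMaybe⁺ f a∈ fa≡b)
... | nothing = ∈-mapMaybe⁺ f a∈ fa≡b

size-⊆-map : ∀ (f : Lit → Lit) {C D : Clause} → lits D ⊆ map f (lits C) → size D ≤ size C
size-⊆-map f {C} {D} D⊆ = subst (size D ≤_) (length-map f (lits C)) (Unique⇒length≤ (distinct D) D⊆)

≈ᶜ⇒⊇ : ∀ {C D} → C ≈ᶜ D → lits D ⊆ lits C
≈ᶜ⇒⊇ C≈D {l} = Equivalence.from (C≈D l)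

resolvent-⊆ˡ : ∀ {C D R} (r : Resolvent C D R) → lits C ⊆ proj₁ r ∷ lits R
resolvent-⊆ˡ {C} (l , l∈C , _ , _ , members) {z} z∈C with z ≟ₗ l
... | yes refl = here refl
... | no z≢l = there (Equivalence.from (members z)
  (inj₁ z∈C , z≢l , λ { refl → noClash C l l∈C z∈C }))

resolvent-⊆ʳ : ∀ {C D R} (r : Resolvent C D R) → lits D ⊆ neg (proj₁ r) ∷ lits R
resolvent-⊆ʳ {D = D} (l , _ , nl∈D , _ , members) {z} z∈D with z ≟ₗ neg l
... | yes refl = here refl
... | no z≢nl = there (Equivalence.from (members z)
  (inj₂ z∈D , (λ { refl → noClash D (neg z) nl∈D (subst (_∈ lits D) (sym (neg-involutive z)) z∈D) }) , z≢nl))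

∈-∷-≢ : ∀ {z k : Lit} {S} → z ∈ k ∷ S → z ≢ k → z ∈ S
∈-∷-≢ (here z≡k) z≢k = contradiction z≡k z≢k
∈-∷-≢ (there z∈S) _ = z∈S

-- The resolvent keeps every literal of D₁ ∪ D₂ other than k, k̄; all of
-- them lie in S, so the single-clash condition is inherited from S.
resolvent-⊆ : ∀ {D₁ D₂ : Clause} {k : Lit} {S : List Lit} → ¬ Tautological S →
  lits D₁ ⊆ k ∷ S → lits D₂ ⊆ neg k ∷ S → k ∈ lits D₁ → neg k ∈ lits D₂ →
  Σ[ R ∈ Clause ] Resolvent D₁ D₂ R × lits R ⊆ S
resolvent-⊆ {D₁} {D₂} {k} {S} ¬tautS D₁⊆ D₂⊆ k∈D₁ nk∈D₂ = R , (k , k∈D₁ , nk∈D₂ , single , members) , R⊆S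
  where
  keep? : (z : Lit) → Dec (z ≢ k × z ≢ neg k)
  keep? z = ¬? (z ≟ₗ k) ×-dec ¬? (z ≟ₗ neg k)
  both = deduplicate _≟ₗ_ (lits D₁ ++ lits D₂)
  RL = filter keep? both
  kept : ∀ {z} → z ∈ RL → (z ∈ lits D₁ ⊎ z ∈ lits D₂) × z ≢ k × z ≢ neg k
  kept z∈ = let z∈both , z≢k , z≢nk = ∈-filter⁻ keep? {xs = both} z∈
            in ∈-++⁻ (lits D₁) (∈-deduplicate⁻ _≟ₗ_ _ z∈both) , z≢k , z≢nk
  R⊆S : RL ⊆ S
  R⊆S z∈ with kept z∈
  ... | inj₁ z∈D₁ , z≢k , _   = ∈-∷-≢ (D₁⊆ z∈D₁) z≢k
  ... | inj₂ z∈D₂ , _ , z≢nk = ∈-∷-≢ (D₂⊆ z∈D₂) z≢nk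
  R : Clause
  R = mkClause RL (filter⁺ keep? (deduplicate-! (lits D₁ ++ lits D₂)))
                  (λ z z∈ nz∈ → ¬tautS (z , R⊆S z∈ , R⊆S nz∈))
  single : ∀ z → z ∈ lits D₁ → neg z ∈ lits D₂ → z ≡ k
  single z z∈D₁ nz∈D₂ with z ≟ₗ k | neg z ≟ₗ neg k
  ... | yes z≡k | _ = z≡k
  ... | no _ | yes nz≡nk = neg-injective nz≡nk
  ... | no z≢k | no nz≢nk = contradiction (z , ∈-∷-≢ (D₁⊆ z∈D₁) z≢k , ∈-∷-≢ (D₂⊆ nz∈D₂) nz≢nk) ¬tautS
  members : ∀ z → (z ∈ RL) ⇔ ((z ∈ lits D₁ ⊎ z ∈ lits D₂) × z ≢ k × z ≢ neg k)
  members z = mk⇔ kept λ (z∈D , z≢k , z≢nk) →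
    ∈-filter⁺ keep? {xs = both} (∈-deduplicate⁺ _≟ₗ_ ([ ∈-++⁺ˡ , ∈-++⁺ʳ (lits D₁) ] z∈D)) (z≢k , z≢nk)

strahler : ℕ → ℕ → ℕ
strahler a b = if a ≡ᵇ b then suc a else a ⊔ b

strahler-cases : ∀ a b → (a ≡ b × strahler a b ≡ suc a) ⊎ (a ≢ b × strahler a b ≡ a ⊔ b)
strahler-cases a b with a ≡ᵇ b in eq
... | true  = inj₁ (ℕₚ.≡ᵇ⇒≡ a b (subst T (sym eq) tt) , refl)
... | false = inj₂ ((λ a≡b → subst T eq (ℕₚ.≡⇒≡ᵇ a b a≡b)) , refl)

⊔≤strahler : ∀ a b → a ⊔ b ≤ strahler a b
⊔≤strahler a b with strahler-cases a b
... | inj₁ (refl , e) rewrite e | ℕₚ.⊔-idem a = ℕₚ.n≤1+n a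
... | inj₂ (_ , e) rewrite e = ℕₚ.≤-refl

m≤strahler : ∀ a b → a ≤ strahler a b
m≤strahler a b = ℕₚ.≤-trans (ℕₚ.m≤m⊔n a b) (⊔≤strahler a b)

n≤strahler : ∀ a b → b ≤ strahler a b
n≤strahler a b = ℕₚ.≤-trans (ℕₚ.m≤n⊔m a b) (⊔≤strahler a b)

-- If a = b but a' ≢ b', one of a', b' exceeds a.
strahler-mono : ∀ {a b a' b'} → a ≤ a' → b ≤ b' → strahler a b ≤ strahler a' b'
strahler-mono {a} {b} {a'} {b'} a≤a' b≤b' with strahler-cases a b | strahler-cases a' b'
... | inj₂ (_ , e) | _ rewrite e = ℕₚ.≤-trans (ℕₚ.⊔-mono-≤ a≤a' b≤b') (⊔≤strahler a' b')
... | inj₁ (refl , e) | inj₁ (_ , e') rewrite e | e' = s≤s a≤a'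
... | inj₁ (refl , e) | inj₂ (a'≢b' , e') rewrite e | e'
  with ℕₚ.m≤n⇒m<n∨m≡n a≤a' | ℕₚ.m≤n⇒m<n∨m≡n b≤b'
...   | inj₁ a<a' | _         = ℕₚ.m≤n⇒m≤n⊔o b' a<a'
...   | inj₂ _    | inj₁ a<b' = ℕₚ.m≤n⇒m≤o⊔n a' a<b'
...   | inj₂ refl | inj₂ refl = contradiction refl a'≢b'

xnor : Bool → Bool → Bool
xnor true  b = b
xnor false b = not b

xnor-involutive : ∀ c b → xnor c (xnor c b) ≡ b
xnor-involutive true  b = refl
xnor-involutive false b = not-involutive b

-- Under pullBack φ a literal m is true iff f m is true under φ.
module PullBack (f : Lit → Lit) (f-neg : ∀ m → f (neg m) ≡ neg (f m))
                (moved : List ℕ) (fixes : ∀ v → Any (v ≡_) moved ⊎ f (v , true) ≡ (v , true)) where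

  pullBack : PAss → PAss
  pullBack φ = record { val = val′ ; dom = moved ++ dom φ ; finite = finite′ }
    where
    val′ : ℕ → Maybe Bool
    val′ v = Maybe.map (xnor (proj₂ (f (v , true)))) (val φ (proj₁ (f (v , true))))
    finite′ : ∀ v → val′ v ≢ nothing → Any (v ≡_) (moved ++ dom φ)
    finite′ v defined with fixes v
    ... | inj₁ v∈moved = ++⁺ˡ v∈moved
    ... | inj₂ fixed = ++⁺ʳ moved (finite φ v λ undefined →
      defined (cong (Maybe.map _) (trans (cong (val φ ∘ proj₁) fixed) undefined)))

  f-at : ∀ v b → f (v , b) ≡ (proj₁ (f (v , true)) , xnor (proj₂ (f (v , true))) b)
  f-at v true with f (v , true)
  ... | u , true  = refl
  ... | u , false = refl
  f-at v false rewrite f-neg (v , true) with f (v , true)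
  ... | u , true  = refl
  ... | u , false = refl

  pullBack-sat : ∀ φ m → SatLit φ (f m) → SatLit (pullBack φ) m
  pullBack-sat φ (v , b) sat = begin
    Maybe.map (xnor c) (val φ u) ≡⟨ cong (Maybe.map (xnor c)) sat′ ⟩
    just (xnor c (xnor c b))    ≡⟨ cong just (xnor-involutive c b) ⟩
    just b                       ∎
    where
    open ≡-Reasoning
    u = proj₁ (f (v , true))
    c = proj₂ (f (v , true))
    sat′ : val φ u ≡ just (xnor c b)
    sat′ = subst (λ w → val φ (proj₁ w) ≡ just (proj₂ w)) (f-at v b) sat

extendAt : PAss → ℕ → PAss
extendAt φ v = record { val = val′ ; dom = v ∷ dom φ ; finite = finite′ }
  where
  val′ : ℕ → Maybe Bool
  val′ w with w ℕ.≟ v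
  ... | yes _ = just (fromMaybe false (val φ v))
  ... | no _  = val φ w
  finite′ : ∀ w → val′ w ≢ nothing → Any (w ≡_) (v ∷ dom φ)
  finite′ w defined with w ℕ.≟ v
  ... | yes w≡v = here w≡v
  ... | no _    = there (finite φ w defined)

extendAt-extends : ∀ φ v {l} → SatLit φ l → SatLit (extendAt φ v) l
extendAt-extends φ v {w , b} sat with w ℕ.≟ v
... | yes refl rewrite sat = refl
... | no _ = sat

extendAt-decides : ∀ φ z {v} → var z ≡ v → SatLit (extendAt φ v) z ⊎ SatLit (extendAt φ v) (neg z)
extendAt-decides φ (v , b) refl with v ℕ.≟ v
... | no v≢v = contradiction refl v≢v
... | yes _ with fromMaybe false (val φ v) | b
...   | true  | true  = inj₁ refl
...   | true  | false = inj₂ refl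
...   | false | true  = inj₂ refl
...   | false | false = inj₁ refl

record Derivation (G : ClauseSet) (h w : ℕ) (S : List Lit) : Set where
  field
    tree       : RTree
    wellFormed : WellFormed tree
    leavesIn   : LeavesIn G tree
    label⊆     : lits (label tree) ⊆ S
    hts≤       : hts tree ≤ h
    whdT≤      : whdT tree ≤ w
open Derivation

weaken : ∀ {G h w S h' w' S'} → h ≤ h' → w ≤ w' →
  (d : Derivation G h w S) → lits (label (tree d)) ⊆ S' → Derivation G h' w' S'
weaken h≤ w≤ d ⊆S' = record
  { tree       = tree d
  ; wellFormed = wellFormed d
  ; leavesIn   = leavesIn d
  ; label⊆     = ⊆S'
  ; hts≤       = ℕₚ.≤-trans (hts≤ d) h≤
  ; whdT≤      = ℕₚ.≤-trans (whdT≤ d) w≤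
  }

module Substitution (x y : Lit) where

  σ : Lit → Lit
  σ = substLit x y

  σ-x : σ x ≡ y
  σ-x with x ≟ₗ x
  ... | yes _ = refl
  ... | no x≢x = contradiction refl x≢x

  σ-negx : σ (neg x) ≡ neg y
  σ-negx with neg x ≟ₗ x
  ... | yes nx≡x = contradiction nx≡x (neg≢ x)
  ... | no _ with neg x ≟ₗ neg x
  ...   | yes _ = refl
  ...   | no nx≢nx = contradiction refl nx≢nx

  σ-fixes : ∀ m → var m ≢ var x → σ m ≡ m
  σ-fixes m m≢x with m ≟ₗ x
  ... | yes refl = contradiction refl m≢x
  ... | no _ with m ≟ₗ neg x
  ...   | yes refl = contradiction refl m≢x
  ...   | no _ = refl

  var-cases : ∀ m → var m ≢ var x ⊎ m ≡ x ⊎ m ≡ neg x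
  var-cases m with var m ℕ.≟ var x
  ... | no m≢x = inj₁ m≢x
  ... | yes same = inj₂ (var≡⇒≡⊎≡neg m x same)

  σ-neg : ∀ m → σ (neg m) ≡ neg (σ m)
  σ-neg m with var-cases m
  ... | inj₁ m≢x = trans (σ-fixes (neg m) m≢x) (cong neg (sym (σ-fixes m m≢x)))
  ... | inj₂ (inj₁ refl) = trans σ-negx (cong neg (sym σ-x))
  ... | inj₂ (inj₂ refl) = begin
    σ (neg (neg x)) ≡⟨ cong σ (neg-involutive x) ⟩
    σ x             ≡⟨ σ-x ⟩
    y               ≡⟨ sym (neg-involutive y) ⟩
    neg (neg y)     ≡⟨ cong neg (sym σ-negx) ⟩
    neg (σ (neg x)) ∎
    where open ≡-Reasoning

  σ-fixes-or-var : ∀ m → σ m ≡ m ⊎ var (σ m) ≡ var y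
  σ-fixes-or-var m with var-cases m
  ... | inj₁ m≢x = inj₁ (σ-fixes m m≢x)
  ... | inj₂ (inj₁ refl) = inj₂ (cong var σ-x)
  ... | inj₂ (inj₂ refl) = inj₂ (cong var σ-negx)

  image : Clause → List Lit
  image C = map σ (lits C)

  image-⊥ : ∀ {C} → IsEmpty C → image C ≡ []
  image-⊥ = cong (map σ)

  tautological-image⇒var : ∀ C {z} → z ∈ image C → neg z ∈ image C → var z ≡ var y
  tautological-image⇒var C z∈ nz∈ with ∈-map⁻ σ z∈ | ∈-map⁻ σ nz∈
  ... | m₁ , m₁∈ , refl | m₂ , m₂∈ , e₂ with σ-fixes-or-var m₁ | σ-fixes-or-var m₂
  ...   | inj₂ var≡ | _ = var≡
  ...   | inj₁ _ | inj₂ var≡ = trans (cong var e₂) var≡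
  ...   | inj₁ fixed₁ | inj₁ fixed₂ =
    contradiction (subst (_∈ lits C) (trans (sym fixed₂) (trans (sym e₂) (cong neg fixed₁))) m₂∈)
                  (noClash C m₁ m₁∈)

  substClause-just : (C : Clause) → ¬ Tautological (image C) →
    Σ[ D ∈ Clause ] substClause x y C ≡ just D × lits D ≡ deduplicate _≟ₗ_ (image C)
  substClause-just C ¬taut
    with any? (λ l → neg l ∈? deduplicate _≟ₗ_ (image C)) (deduplicate _≟ₗ_ (image C))
  ... | yes p = let z , z∈ , nz∈ = find p in
    contradiction (z , ∈-deduplicate⁻ _≟ₗ_ _ z∈ , ∈-deduplicate⁻ _≟ₗ_ _ nz∈) ¬taut
  ... | no _ = _ , refl , refl

  fixes-outside-x : ∀ v → Any (v ≡_) (var x ∷ []) ⊎ σ (v , true) ≡ (v , true)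
  fixes-outside-x v with var-cases (v , true)
  ... | inj₁ v≢x = inj₂ (σ-fixes (v , true) v≢x)
  ... | inj₂ (inj₁ v≡x) = inj₁ (here (cong var v≡x))
  ... | inj₂ (inj₂ v≡nx) = inj₁ (here (cong var v≡nx))

  open PullBack σ σ-neg (var x ∷ []) fixes-outside-x

  unsat-subst : (F : ClauseSet) → Unsat F → Unsat (substCS x y F)
  unsat-subst F unsatF φ satF′ = unsatF ψ (All.tabulate satisfied)
    where
    φ⁺ = extendAt φ (var y)
    ψ = pullBack φ⁺
    image-sat : ∀ C {z} → z ∈ image C → SatLit φ⁺ z → SatClause ψ C
    image-sat C z∈ sat with ∈-map⁻ σ z∈
    ... | m , m∈ , refl = lose m∈ (pullBack-sat φ⁺ m sat)
    satisfied : ∀ {C} → C ∈ F → SatClause ψ C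
    satisfied {C} C∈F with tautological? (image C)
    ... | yes (z , z∈ , nz∈) =
      [ image-sat C z∈ , image-sat C nz∈ ] (extendAt-decides φ z (tautological-image⇒var C z∈ nz∈))
    ... | no ¬taut with substClause-just C ¬taut
    ...   | D , C↦D , D≡ with find (All.lookup satF′ (∈-mapMaybe⁺ (substClause x y) C∈F C↦D))
    ...     | z , z∈D , sat =
      image-sat C (∈-deduplicate⁻ _≟ₗ_ (image C) (subst (z ∈_) D≡ z∈D)) (extendAt-extends φ (var y) sat)

  module _ (F : ClauseSet) where

    F′ : ClauseSet
    F′ = substCS x y F

    Substituted : RTree → Set
    Substituted T = Tautological (image (label T)) ⊎ Derivation F′ (hts T) (whdT T) (image (label T))

    -- What the subtree on one side of a node contributes, where S is the
    -- image of the node's label and k the image of the pivot on that side.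
    data Contribution (T : RTree) (S : List Lit) (k : Lit) : Set where
      inside    : Derivation F′ (hts T) (whdT T) S → Contribution T S k
      contains  : (d : Derivation F′ (hts T) (whdT T) (image (label T))) →
                  k ∈ lits (label (tree d)) → k ∉ S → Contribution T S k
      opposite  : neg k ∈ S → Contribution T S k

    contribution : ∀ T {S k} → ¬ Tautological S → image (label T) ⊆ k ∷ S → Substituted T → Contribution T S k
    contribution _ ¬tautS image⊆ (inj₁ taut) = opposite (tautological-⊆∷ taut image⊆ ¬tautS)
    contribution _ {S} {k} ¬tautS image⊆ (inj₂ d) with ⊆∷⇒∈∨⊆ (image⊆ ∘ label⊆ d)
    ... | inj₂ label⊆S = inside (weaken ℕₚ.≤-refl ℕₚ.≤-refl d label⊆S)
    ... | inj₁ k∈label with k ∈? S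
    ...   | no k∉S = contains d k∈label k∉S
    ...   | yes k∈S = inside (weaken ℕₚ.≤-refl ℕₚ.≤-refl d (∈-∷⁺ʳ k∈S id ∘ image⊆ ∘ label⊆ d))

    resolve : ∀ {P T₁ T₂ k S} → ¬ Tautological S →
      image (label T₁) ⊆ k ∷ S → image (label T₂) ⊆ neg k ∷ S →
      (d₁ : Derivation F′ (hts T₁) (whdT T₁) (image (label T₁))) →
      (d₂ : Derivation F′ (hts T₂) (whdT T₂) (image (label T₂))) →
      k ∈ lits (label (tree d₁)) → neg k ∈ lits (label (tree d₂)) →
      Derivation F′ (hts (node P T₁ T₂)) (whdT (node P T₁ T₂)) S
    resolve {T₁ = T₁} {T₂} ¬tautS image₁⊆ image₂⊆ d₁ d₂ k∈₁ nk∈₂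
      with resolvent-⊆ {label (tree d₁)} {label (tree d₂)} ¬tautS (image₁⊆ ∘ label⊆ d₁) (image₂⊆ ∘ label⊆ d₂) k∈₁ nk∈₂
    ... | R , resolvent , R⊆S = record
      { tree       = node R (tree d₁) (tree d₂)
      ; wellFormed = resolvent , wellFormed d₁ , wellFormed d₂
      ; leavesIn   = leavesIn d₁ , leavesIn d₂
      ; label⊆     = R⊆S
      ; hts≤       = strahler-mono (hts≤ d₁) (hts≤ d₂)
      ; whdT≤      = ℕₚ.⊔-mono-≤ (ℕₚ.⊔-mono-≤ (whdT≤ d₁) (whdT≤ d₂)) (ℕₚ.⊓-mono-≤ size₁≤ size₂≤)
      }
      where
      size₁≤ : size (label (tree d₁)) ≤ size (label T₁)
      size₁≤ = size-⊆-map σ {label T₁} {label (tree d₁)} (label⊆ d₁)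
      size₂≤ : size (label (tree d₂)) ≤ size (label T₂)
      size₂≤ = size-⊆-map σ {label T₂} {label (tree d₂)} (label⊆ d₂)

    node-derivation : ∀ {P T₁ T₂ k S} → ¬ Tautological S →
      image (label T₁) ⊆ k ∷ S → image (label T₂) ⊆ neg k ∷ S →
      Contribution T₁ S k → Contribution T₂ S (neg k) →
      Derivation F′ (hts (node P T₁ T₂)) (whdT (node P T₁ T₂)) S
    node-derivation {T₁ = T₁} {T₂} _ _ _ (inside d) _ =
      weaken (m≤strahler (hts T₁) (hts T₂)) (ℕₚ.m≤n⇒m≤n⊔o _ (ℕₚ.m≤m⊔n (whdT T₁) (whdT T₂))) d (label⊆ d)
    node-derivation {T₁ = T₁} {T₂} _ _ _ _ (inside d) =
      weaken (n≤strahler (hts T₁) (hts T₂)) (ℕₚ.m≤n⇒m≤n⊔o _ (ℕₚ.m≤n⊔m (whdT T₁) (whdT T₂))) d (label⊆ d)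
    node-derivation {k = k} ¬tautS _ _ (opposite nk∈S) (opposite nnk∈S) =
      contradiction (neg k , nk∈S , nnk∈S) ¬tautS
    node-derivation _ _ _ (opposite nk∈S) (contains _ _ nk∉S) = contradiction nk∈S nk∉S
    node-derivation {k = k} _ _ _ (contains _ _ k∉S) (opposite nnk∈S) =
      contradiction (subst (_∈ _) (neg-involutive k) nnk∈S) k∉S
    node-derivation {P} {T₁} {T₂} ¬tautS image₁⊆ image₂⊆ (contains d₁ k∈₁ _) (contains d₂ nk∈₂ _) =
      resolve {P} {T₁} {T₂} ¬tautS image₁⊆ image₂⊆ d₁ d₂ k∈₁ nk∈₂

    leaf-derivation : ∀ {C} → C ∈ˢ F → Substituted (leaf C)
    leaf-derivation {C} C∈F with find C∈F
    ... | C₀ , C₀∈F , C≈C₀ with tautological? (image C)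
    ...   | yes taut = inj₁ taut
    ...   | no ¬taut with substClause-just C₀ (¬taut ∘ tautological-⊆ (⊆.map⁺ σ (≈ᶜ⇒⊇ {C} {C₀} C≈C₀)))
    ...     | D , C₀↦D , D≡ = inj₂ record
      { tree       = leaf D
      ; wellFormed = tt
      ; leavesIn   = Any.map (λ { refl l → mk⇔ id id }) (∈-mapMaybe⁺ (substClause x y) C₀∈F C₀↦D)
      ; label⊆     = λ {z} z∈D →
          ⊆.map⁺ σ (≈ᶜ⇒⊇ {C} {C₀} C≈C₀) (∈-deduplicate⁻ _≟ₗ_ (image C₀) (subst (z ∈_) D≡ z∈D))
      ; hts≤       = z≤n
      ; whdT≤      = z≤n
      }

    derivation : ∀ T → WellFormed T → LeavesIn F T → Substituted T
    derivation (leaf C) _ C∈F = leaf-derivation {C} C∈F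
    derivation (node P T₁ T₂) (resolvent , wf₁ , wf₂) (leaves₁ , leaves₂) with tautological? (image P)
    ... | yes taut = inj₁ taut
    ... | no ¬taut = inj₂ (node-derivation {P} ¬taut image₁⊆ image₂⊆
      (contribution T₁ ¬taut image₁⊆ (derivation T₁ wf₁ leaves₁))
      (contribution T₂ ¬taut image₂⊆ (derivation T₂ wf₂ leaves₂)))
      where
      l = proj₁ resolvent
      image₁⊆ : image (label T₁) ⊆ σ l ∷ image P
      image₁⊆ = ⊆.map⁺ σ (resolvent-⊆ˡ {label T₁} {label T₂} {P} resolvent)
      image₂⊆ : image (label T₂) ⊆ neg (σ l) ∷ image P
      image₂⊆ = subst (λ k → image (label T₂) ⊆ k ∷ image P) (σ-neg l)
                  (⊆.map⁺ σ (resolvent-⊆ʳ {label T₁} {label T₂} {P} resolvent))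

    refutation-subst : ∀ T → Refutation F T →
      Σ[ T′ ∈ RTree ] Refutation F′ T′ × hts T′ ≤ hts T × whdT T′ ≤ whdT T
    refutation-subst T (wf , leaves , empty) with derivation T wf leaves
    ... | inj₁ (_ , z∈ , _) = contradiction (subst (_ ∈_) (image-⊥ {label T} empty) z∈) λ ()
    ... | inj₂ d = tree d , (wellFormed d , leavesIn d , label≡[]) , hts≤ d , whdT≤ d
      where label≡[] = ⊆[]⇒≡[] (subst (_ ∈_) (image-⊥ {label T} empty) ∘ label⊆ d)

lemma4p5 : (F : ClauseSet) (x y : Lit) → Unsat F →
    Unsat (substCS x y F)
    × (∀ (k : ℕ) → hd≤ F k → hd≤ (substCS x y F) k)
    × (∀ (k : ℕ) → whd≤ F k → whd≤ (substCS x y F) k)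
lemma4p5 F x y unsatF =
    unsat-subst F unsatF
  , (λ k (T , refutation , hts≤k) → let T′ , refutation′ , hts≤ , _ = refutation-subst F T refutation
                                     in T′ , refutation′ , ℕₚ.≤-trans hts≤ hts≤k)
  , (λ k (T , refutation , whd≤k) → let T′ , refutation′ , _ , whd≤ = refutation-subst F T refutation
                                     in T′ , refutation′ , ℕₚ.≤-trans whd≤ whd≤k)
  where open Substitution x y
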